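{- There is no AND-OR Boolean network $f$ with $i(f)\geq 2$ whose interaction graph $G(f)$ has no loops.
   Context: A Boolean network on $n$ variables is a map $f=(f_1,\dots,f_n):\{0,1\}^n\to\{0,1\}^n$. Its interaction graph $G(f)$ is the digraph on $[n]$ with an arc $(i,j)$ iff $f_j$ depends on variable $i$ (there is $x$ such that flipping $x_i$ changes $f_j(x)$); a loop is an arc $(i,i)$. An AND-OR network is one in which each local function $f_i$ is either the conjunction or the disjunction of the variables it depends on. $f$ is $k$-independent if for every set $I=\{i_1,\dots,i_k\}\subseteq[n]$ of $k$ indices and every $a\in\{0,1\}^k$ there is a fixed point $x$ of $f$ with $(x_{i_1},\dots,x_{i_k})=a$; $i(f)$ is the maximum $k$ such that $f$ is $k$-independent. -}

module Defs where

open import Data.Nat using (ℕ; _≤_)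
open import Data.Fin using (Fin; _≟_)
open import Data.Bool using (Bool; true; false; not; if_then_else_)
open import Data.Product using (Σ; ∃; _×_; _,_)
open import Data.Sum using (_⊎_)
open import Relation.Binary.PropositionalEquality using (_≡_; _≢_)
open import Relation.Nullary using (¬_; does)
open import Function.Definitions using (Injective)
open import Function.Bundles using (_⇔_)

-- configurations x ∈ {0,1}^n, with 0 = false, 1 = true
Config : ℕ → Set
Config n = Fin n → Bool

BN : ℕ → Set
BN n = Config n → Config n

flipAt : ∀ {n} → Config n → Fin n → Config n
flipAt x i k = if does (k ≟ i) then not (x i) else x k

-- f_j depends on variable i  (arc (i,j) of the interaction graph G(f))
Arc : ∀ {n} → BN n → Fin n → Fin n → Set
Arc f i j = ∃ λ x → f (flipAt x i) j ≢ f x j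

Loopless : ∀ {n} → BN n → Set
Loopless {n} f = (i : Fin n) → ¬ Arc f i i

IsAnd : ∀ {n} → BN n → Fin n → Set
IsAnd {n} f j = (x : Config n) →
  (f x j ≡ true) ⇔ ((i : Fin n) → Arc f i j → x i ≡ true)

IsOr : ∀ {n} → BN n → Fin n → Set
IsOr {n} f j = (x : Config n) →
  (f x j ≡ true) ⇔ (∃ λ i → Arc f i j × x i ≡ true)

AndOr : ∀ {n} → BN n → Set
AndOr {n} f = (j : Fin n) → IsAnd f j ⊎ IsOr f j

IsFixedPoint : ∀ {n} → BN n → Config n → Set
IsFixedPoint {n} f x = (i : Fin n) → f x i ≡ x i

-- k-independence: for every set I = {i_1,...,i_k} of k indices (given as an
-- injective enumeration ι : Fin k → Fin n) and every a ∈ {0,1}^k there is a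
-- fixed point x with x_{i_t} = a_t for all t
Independent : ∀ {n} → ℕ → BN n → Set
Independent {n} k f =
  (ι : Fin k → Fin n) → Injective _≡_ _≡_ ι →
  (a : Fin k → Bool) →
  ∃ λ x → IsFixedPoint f x × ((t : Fin k) → x (ι t) ≡ a t)

-- i(f) ≥ m : f is k-independent for some k with m ≤ k ≤ n
-- (i(f) is the maximum such k; k-independence is only meaningful for k ≤ n)
IndepAtLeast : ∀ {n} → ℕ → BN n → Set
IndepAtLeast {n} m f = ∃ λ k → m ≤ k × k ≤ n × Independent k f

{-# OPTIONS --safe #-}

-- Take any node j. If f_j is a conjunction and i → j is an arc, then i ≠ j
-- (no loops), and a fixed point with x_i = 0 and x_j = 1 would violate
-- x_j = f_j(x) ≤ x_i; so 2-independence leaves j without in-arcs. Then f_j is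
-- the empty conjunction, constantly 1, and no fixed point has x_j = 0.
-- Disjunctions are dual.

module Submission where

open import Defs
open import Data.Nat using (ℕ; suc; _≤_; s≤s)
open import Data.Nat.Properties using (≤-trans)
open import Data.Fin using (Fin; _≟_; inject≤; punchOut)
open import Data.Fin.Patterns using (0F; 1F)
open import Data.Fin.Properties using (inject≤-injective; punchIn-punchOut)
open import Data.Fin.Permutation using (Permutation′; _⟨$⟩ʳ_; insert; insert-punchIn; id)
open import Data.Bool using (Bool; true; false; not)
open import Data.Bool.Properties using (not-¬)
open import Data.Product using (∃; _×_; _,_)
open import Data.Sum using (_⊎_; inj₁; inj₂)
open import Data.Empty using (⊥-elim)
open import Relation.Nullary using (¬_; yes; no)
open import Relation.Binary.PropositionalEquality using (_≡_; _≢_; refl; sym; trans; cong; subst)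
open import Function.Bundles using (Equivalence; Injection)
open import Function.Definitions using (Injective)
open import Function.Properties.Inverse using (↔⇒↣)

PairIndependent : ∀ {n} → BN n → Set
PairIndependent {n} f = (i j : Fin n) → i ≢ j → (a b : Bool) →
  ∃ λ x → IsFixedPoint f x × x i ≡ a × x j ≡ b

module _ {m : ℕ} (i j : Fin (suc (suc m))) (i≢j : i ≢ j) where

  pairPermutation : Permutation′ (suc (suc m))
  pairPermutation = insert 0F i (insert 0F (punchOut i≢j) id)

  pairPermutation-0 : pairPermutation ⟨$⟩ʳ 0F ≡ i
  pairPermutation-0 = refl

  pairPermutation-1 : pairPermutation ⟨$⟩ʳ 1F ≡ j
  pairPermutation-1 = trans (insert-punchIn 0F i (insert 0F (punchOut i≢j) id) 0F)
                            (punchIn-punchOut i≢j)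

independent⇒pairIndependent : ∀ {n k} (f : BN n) →
  2 ≤ k → k ≤ n → Independent k f → PairIndependent f
independent⇒pairIndependent {n} {k} f (s≤s (s≤s _)) k≤n@(s≤s (s≤s _)) indep i j i≢j a b =
  let x , fixed , x∘ι≡values = indep ι ι-injective values
  in x , fixed , trans (cong x (sym (pairPermutation-0 i j i≢j))) (x∘ι≡values 0F)
                , trans (cong x (sym (pairPermutation-1 i j i≢j))) (x∘ι≡values 1F)
  where
  π : Permutation′ n
  π = pairPermutation i j i≢j
  ι : Fin k → Fin n
  ι t = π ⟨$⟩ʳ inject≤ t k≤n
  ι-injective : Injective _≡_ _≡_ ι
  ι-injective {s} {t} e = inject≤-injective k≤n k≤n s t (Injection.injective (↔⇒↣ π) e)
  values : Fin k → Bool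
  values 0F = a
  values 1F = b
  values _ = false

module _ {n} (f : BN n) {j : Fin n} (noInArc : ∀ i → ¬ Arc f i j) where

  and-source-true : IsAnd f j → ∀ x → f x j ≡ true
  and-source-true isAnd x = Equivalence.from (isAnd x) (λ i arc → ⊥-elim (noInArc i arc))

  or-source-false : IsOr f j → ∀ x → f x j ≡ false
  or-source-false isOr x with f x j in fxj
  ... | false = refl
  ... | true  = let i , arc , _ = Equivalence.to (isOr x) fxj in ⊥-elim (noInArc i arc)

  andOr-source-constant : IsAnd f j ⊎ IsOr f j → ∃ λ b → ∀ x → f x j ≡ b
  andOr-source-constant (inj₁ isAnd) = true , and-source-true isAnd
  andOr-source-constant (inj₂ isOr)  = false , or-source-false isOr

module _ {n} (f : BN n) (pairs : PairIndependent f) where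

  pairIndependent⇒nonConstant : ∀ {j k} → j ≢ k → (b : Bool) → ¬ (∀ x → f x j ≡ b)
  pairIndependent⇒nonConstant {j} {k} j≢k b constant =
    let x , fixed , xj≡notb , _ = pairs j k j≢k (not b) false
    in not-¬ (trans (sym (fixed j)) (constant x)) xj≡notb

  and-inArc⇒loop : ∀ {i j} → IsAnd f j → Arc f i j → i ≡ j
  and-inArc⇒loop {i} {j} isAnd arc with i ≟ j
  ... | yes i≡j = i≡j
  ... | no  i≢j =
    let x , fixed , xi≡false , xj≡true = pairs i j i≢j false true
    in ⊥-elim (not-¬ (Equivalence.to (isAnd x) (trans (fixed j) xj≡true) i arc) xi≡false)

  or-inArc⇒loop : ∀ {i j} → IsOr f j → Arc f i j → i ≡ j
  or-inArc⇒loop {i} {j} isOr arc with i ≟ j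
  ... | yes i≡j = i≡j
  ... | no  i≢j =
    let x , fixed , xi≡true , xj≡false = pairs i j i≢j true false
    in ⊥-elim (not-¬ (trans (sym (fixed j)) (Equivalence.from (isOr x) (i , arc , xi≡true))) xj≡false)

  andOr-inArc⇒loop : ∀ {i j} → IsAnd f j ⊎ IsOr f j → Arc f i j → i ≡ j
  andOr-inArc⇒loop (inj₁ isAnd) = and-inArc⇒loop isAnd
  andOr-inArc⇒loop (inj₂ isOr)  = or-inArc⇒loop isOr

  loopless-andOr-noInArc : Loopless f → ∀ {j} → IsAnd f j ⊎ IsOr f j → ∀ i → ¬ Arc f i j
  loopless-andOr-noInArc loopless {j} andOr i arc =
    loopless j (subst (λ i → Arc f i j) (andOr-inArc⇒loop andOr arc) arc)

corollary2p7 : (n : ℕ) (f : BN n) → AndOr f → Loopless f → ¬ IndepAtLeast 2 f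
corollary2p7 n f andOr loopless (k , 2≤k , k≤n , indep) with ≤-trans 2≤k k≤n
... | s≤s (s≤s _) =
  let pairs = independent⇒pairIndependent f 2≤k k≤n indep
      noInArc = loopless-andOr-noInArc f pairs loopless (andOr 0F)
      b , constant = andOr-source-constant f noInArc (andOr 0F)
  in pairIndependent⇒nonConstant f pairs {0F} {1F} (λ ()) b constant
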